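{- Let $X$ be a bounded lattice and let $O:X^2\to X$ be a quasi-overlap function on $X$. Then $O$ is associative (i.e. $O(x,O(y,z))=O(O(x,y),z)$ for all $x,y,z\in X$) if and only if $O$ satisfies the exchange principle: $O(x,O(y,z))=O(y,O(x,z))$ for all $x,y,z\in X$.
   Context: Let $X$ be a bounded lattice with bottom $0$ and top $1$. A function $O:X^2\to X$ is a quasi-overlap function on $X$ if: (OL1) $O(x,y)=O(y,x)$ for all $x,y$; (OL2) $O(x,y)=0$ iff $x=0$ or $y=0$; (OL3) $O(x,y)=1$ iff $x=y=1$; (OL4) $O$ is non-decreasing in each variable. -}

module Defs where

open import Level using (Level; _⊔_)
open import Data.Product using (_×_)
open import Data.Sum using (_⊎_)
open import Function.Bundles using (_⇔_)
open import Relation.Binary.Lattice.Bundles using (BoundedLattice)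

record IsQuasiOverlap {c ℓ₁ ℓ₂ : Level} (X : BoundedLattice c ℓ₁ ℓ₂)
       (O : BoundedLattice.Carrier X → BoundedLattice.Carrier X → BoundedLattice.Carrier X)
       : Set (c ⊔ ℓ₁ ⊔ ℓ₂) where
  open BoundedLattice X
  field
    OL1 : ∀ x y → O x y ≈ O y x
    OL2 : ∀ x y → (O x y ≈ ⊥) ⇔ ((x ≈ ⊥) ⊎ (y ≈ ⊥))
    OL3 : ∀ x y → (O x y ≈ ⊤) ⇔ ((x ≈ ⊤) × (y ≈ ⊤))
    OL4 : ∀ {x x′ y y′} → x ≤ x′ → y ≤ y′ → O x y ≤ O x′ y′

Associative : {c ℓ₁ ℓ₂ : Level} (X : BoundedLattice c ℓ₁ ℓ₂) →
  (BoundedLattice.Carrier X → BoundedLattice.Carrier X → BoundedLattice.Carrier X) → Set (c ⊔ ℓ₁)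
Associative X O = ∀ x y z → O x (O y z) ≈ O (O x y) z
  where open BoundedLattice X

ExchangePrinciple : {c ℓ₁ ℓ₂ : Level} (X : BoundedLattice c ℓ₁ ℓ₂) →
  (BoundedLattice.Carrier X → BoundedLattice.Carrier X → BoundedLattice.Carrier X) → Set (c ⊔ ℓ₁)
ExchangePrinciple X O = ∀ x y z → O x (O y z) ≈ O y (O x z)
  where open BoundedLattice X

{-# OPTIONS --safe #-}
module Submission where

-- Only commutativity (OL1) and congruence are needed, and congruence follows from
-- monotonicity (OL4) by antisymmetry.

open import Defs
open import Level using (Level)
open import Algebra.Core using (Op₂)
open import Algebra.Definitions using (Commutative; Congruent₂)
open import Function.Bundles using (_⇔_; mk⇔)
open import Relation.Binary.Bundles using (Setoid)
open import Relation.Binary.Consequences using (mono₂⇒cong₂)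
open import Relation.Binary.Lattice.Bundles using (BoundedLattice)
import Relation.Binary.Reasoning.Setoid as SetoidReasoning

module _ {c ℓ : Level} (S : Setoid c ℓ) {_∙_ : Op₂ (Setoid.Carrier S)}
         (cong : Congruent₂ (Setoid._≈_ S) _∙_)
         (comm : Commutative (Setoid._≈_ S) _∙_) where

  open Setoid S
  open SetoidReasoning S

  comm∧assoc⇒exchange : (∀ x y z → x ∙ (y ∙ z) ≈ (x ∙ y) ∙ z) →
                        ∀ x y z → x ∙ (y ∙ z) ≈ y ∙ (x ∙ z)
  comm∧assoc⇒exchange assoc x y z = begin
    x ∙ (y ∙ z)  ≈⟨ assoc x y z ⟩
    (x ∙ y) ∙ z  ≈⟨ cong (comm x y) refl ⟩
    (y ∙ x) ∙ z  ≈⟨ assoc y x z ⟨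
    y ∙ (x ∙ z)  ∎

  comm∧exchange⇒assoc : (∀ x y z → x ∙ (y ∙ z) ≈ y ∙ (x ∙ z)) →
                        ∀ x y z → x ∙ (y ∙ z) ≈ (x ∙ y) ∙ z
  comm∧exchange⇒assoc exchange x y z = begin
    x ∙ (y ∙ z)  ≈⟨ cong refl (comm y z) ⟩
    x ∙ (z ∙ y)  ≈⟨ exchange x z y ⟩
    z ∙ (x ∙ y)  ≈⟨ comm z (x ∙ y) ⟩
    (x ∙ y) ∙ z  ∎

proposition3p1 : {c ℓ₁ ℓ₂ : Level} (X : BoundedLattice c ℓ₁ ℓ₂)
    (O : BoundedLattice.Carrier X → BoundedLattice.Carrier X → BoundedLattice.Carrier X) →
    IsQuasiOverlap X O → (Associative X O ⇔ ExchangePrinciple X O)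
proposition3p1 X O isQuasiOverlap =
  mk⇔ (comm∧assoc⇒exchange setoid O-cong OL1)
      (comm∧exchange⇒assoc setoid O-cong OL1)
  where
  open BoundedLattice X
  open IsQuasiOverlap isQuasiOverlap

  O-cong : Congruent₂ _≈_ O
  O-cong = mono₂⇒cong₂ _≈_ _≈_ Eq.sym reflexive antisym OL4
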